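{- The space usage of the entire persistent data structure described in the context is $O(U^{\log 3}+V\log U)$.
   Context: Model: an ephemeral structure manipulates a memory array $A$ with primitives Read$(i)$ (return $A[i]$) and Write$(i,x)$ (set $A[i]=x$). Writes are numbered $1,2,\dots$; $V$ is the number of Writes so far and $A_v$ the state of $A$ after the $v$-th Write. Persistent-Read$(v,i)$ returns $A_v[i]$. The $v$-th Write, Write$(i,x)$, is represented by the point $(i,v)$ labeled $x$ in the integer grid ($x$-axis memory address, $y$-axis time increasing upward); $P$ is the set of such points. $\log$ is base $2$. ST-trees: each node has an axis-parallel grid rectangle, closed (four-sided) or open (unbounded upward). A node of height $h$ (leaves height $0$) has a rectangle of width $2^h$. Each internal node has a left and right child (half width, side by side) and possibly a third, upper child lying on top of one of them; children's rectangles partition the parent's. A leaf is full iff its rectangle contains a point of $P$; an internal node is full iff it has two full children; a node with three children has a full child; open rectangles are not full. Each node stores pointers to its children and parent and its rectangle's coordinates; each leaf also stores the at most one point of $P$ in its rectangle and the value $A_v[i]$ for the point $(i,v)$ at the bottom of its rectangle. Global structure: $U$ is the largest memory address written so far rounded up to a power of $2$. The structure keeps $\lceil V/U\rceil$ ST-trees whose root rectangles have width $U$: the $j$-th (bottom) tree has rectangle $[1..U]\times[(j-1)U+1..jU]$ and the last (top) tree has the open rectangle $[1..U]\times[(\lceil V/U\rceil-1)U+1..\infty)$. It also keeps a log of all Writes, an array $C$ of size $U$, where $C[i]$ holds the current $A[i]$ and a pointer to the leaf containing the highest point of $P$ in column $i$, and a pointer $p$ to the leaf reached by the most recent Persistent-Read.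 Storage: for a fixed constant $0<\epsilon<1$, the top tree is stored as a complete $3$-ary tree of height $\log U$ (space reserved for all potential nodes) in the biased van Emde Boas layout (a tree of height $h$ is split into a top tree of height $\epsilon h$ and $3^{\epsilon h}$ bottom trees of height $(1-\epsilon)h$, each laid out recursively in consecutive memory). A bottom tree is stored contiguously in the same node order but containing only the nodes actually present in it. Write$(i,x)$: if $i>U$, $U$ is doubled and everything is rebuilt by replaying the log; once every $U$ Writes, when the new point lies above the top tree's square, the top tree is compressed into a new bottom tree and a new top tree is created as a complete binary tree (only left/right children) with open rectangles and leaves filled from $C$. Then $C[i]=x$, $V$ is incremented, the point $(i,V)$ is stored in the leaf containing it (reached via $C$) and that leaf is marked full. Reconfiguration: while the parent of the current full node already has three children, the parent is marked full and becomes the current node. For the final node $q$ (whose parent has only two children), every open rectangle in $q$'s subtree is closed by setting its top side to $V$, and a third child is added to $q$'s parent: the root of a new complete binary tree of the same height as $q$, whose open rectangle lies directly on top of $q$'s rectangle and whose leaves are filled with the current values from $C$. -}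

module Defs where

open import Data.Nat using (ℕ; zero; suc; _+_; _*_; _∸_; _^_; _<ᵇ_; _⊔_)
open import Data.Nat.Logarithm using (⌈log₂_⌉)
open import Data.Bool using (if_then_else_)
open import Data.Product using (_×_; _,_; proj₁; proj₂)
open import Data.List using (List; []; _∷_; length; map; foldr)

-- Rectangles are implicit: a node of height h
-- covers 2^h consecutive columns; its left/right children cover the
-- left/right halves; an upper child lies on top of the left child
-- (node3L) or of the right child (node3R).  Full-flags and the
-- closing of open rectangles do not influence the shape (the
-- reconfiguration loop only tests the number of children), and the
-- per-node payload is constant size, so the shape is all that is
-- needed to count space.

data Tree : Set where
  leaf   : Tree
  node2  : (l r : Tree) → Tree
  node3L : (l r u : Tree) → Tree
  node3R : (l r u : Tree) → Tree

size : Tree → ℕ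
size leaf           = 1
size (node2 l r)    = suc (size l + size r)
size (node3L l r u) = suc (size l + size r + size u)
size (node3R l r u) = suc (size l + size r + size u)

cbt : ℕ → Tree
cbt zero    = leaf
cbt (suc h) = node2 (cbt h) (cbt h)

-- Result of inserting a point into a subtree:
--   up t   : the root of t is the current full node and its parent
--            must continue the reconfiguration;
--   done t : the reconfiguration has been completed inside t.
data Res : Set where
  done : Tree → Res
  up   : Tree → Res

resTree : Res → Tree
resTree (done t) = t
resTree (up t)   = t

-- parent with three children: it becomes full and the new current node
three : (Tree → Tree) → Res → Res
three f (done t) = done (f t)
three f (up t)   = up (f t)

-- parent with two children: the child q (the current node) gets a new
-- upper child: a complete binary tree of the same height as q
two : (Tree → Tree) → (Tree → Tree) → Res → Res
two f g (done t) = done (f t)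
two f g (up t)   = done (g t)

-- ins h o t : insert the new point in column offset o (0 ≤ o < 2^h)
-- of a subtree of height h; the point goes to the leaf at the top of
-- that column (the leaf reached via C), which becomes full.
ins : ℕ → ℕ → Tree → Res
ins _ _ leaf = up leaf
ins zero _ t = done t   -- ill-formed (internal node of height 0): unreachable
ins (suc h) o (node2 l r) =
  if o <ᵇ 2 ^ h
  then two (λ l' → node2 l' r) (λ l' → node3L l' r (cbt h)) (ins h o l)
  else two (λ r' → node2 l r') (λ r' → node3R l r' (cbt h)) (ins h (o ∸ 2 ^ h) r)
ins (suc h) o (node3L l r u) =
  if o <ᵇ 2 ^ h
  then three (λ u' → node3L l r u') (ins h o u)
  else three (λ r' → node3L l r' u) (ins h (o ∸ 2 ^ h) r)
ins (suc h) o (node3R l r u) =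
  if o <ᵇ 2 ^ h
  then three (λ l' → node3R l' r u) (ins h o l)
  else three (λ u' → node3R l r u') (ins h (o ∸ 2 ^ h) u)

-- Global structure.  A write is (address i , value x), addresses ≥ 1.

Write : Set
Write = ℕ × ℕ

maxAddr : List Write → ℕ
maxAddr ws = foldr _⊔_ 0 (map proj₁ ws)

-- log U, where U = largest address written so far rounded up to a
-- power of 2 (U = 1 when nothing has been written)
logU : List Write → ℕ
logU ws = ⌈log₂ maxAddr ws ⌉

-- State: (top tree , total number of nodes in all bottom trees ,
--         number of Writes whose points lie in the top tree's square)
State : Set
State = Tree × ℕ × ℕ

-- a Write to address i, with root width U = 2^k: if the new point lies
-- above the top tree's square (the top tree already received U Writes)
-- the top tree is compressed into a bottom tree (of the same nodes) and
-- a fresh top tree (complete binary tree) is created; then the point is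
-- inserted at the top of column i and the tree is reconfigured.
step : ℕ → ℕ → State → State
step k i (top , bot , c) =
  if c <ᵇ 2 ^ k
  then (resTree (ins k (i ∸ 1) top) , bot , suc c)
  else (resTree (ins k (i ∸ 1) (cbt k)) , bot + size top , 1)

run : ℕ → List Write → State → State
run k []             s = s
run k ((i , x) ∷ ws) s = run k ws (step k i s)

-- Since a doubling of U rebuilds everything by replaying the log, the
-- structure after the writes ws equals the one obtained by processing
-- ws from scratch with the final U.
final : List Write → State
final ws = run (logU ws) ws (cbt (logU ws) , 0 , 0)

-- words per ST-tree node (children/parent pointers, rectangle
-- coordinates, stored point and value): a fixed constant
nodeWords : ℕ
nodeWords = 12

ternary : ℕ → ℕ
ternary zero    = 1
ternary (suc h) = suc (3 * ternary h)

-- total space (in words) of the persistent structure after ws: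
-- reserved top tree + bottom trees + log of writes + array C
-- + pointer p and the counters U, V
space : List Write → ℕ
space ws =
  nodeWords * ternary (logU ws)
  + nodeWords * proj₁ (proj₂ (final ws))
  + 2 * length ws
  + 2 * 2 ^ logU ws
  + 3

-- A node receives an upper child only when one of its children q has just
-- become full, and that upper child is a complete binary tree of the height
-- of q, which has fewer than 2·2^height(q) ≤ 2·(points in q) nodes.  Charging
-- these nodes to the points of q, each point pays at most two nodes per level,
-- so an ST-tree of height h holding n points has at most 2^(h+1) + 2hn nodes.
-- A top tree is compressed only after it has received U = 2^(log U) points,
-- which therefore also pay for its initial 2^(log U + 1) nodes: the bottom
-- trees have at most 2(1 + log U) nodes per Write, and the reserved 3-ary top
-- tree has fewer than 2·3^(log U) = 2·U^(log 3) nodes.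
module Submission where

open import Defs
open import Data.Nat using (ℕ; zero; suc; _+_; _*_; _^_; _∸_; _≤_; _<_; _<ᵇ_; s≤s)
open import Data.Nat.Properties
open import Data.Nat.Tactic.RingSolver using (solve-∀)
open import Data.Product using (∃-syntax; _×_; _,_; proj₁; proj₂)
open import Data.Sum using (_⊎_; inj₁; inj₂)
open import Data.Bool using (true; false)
open import Data.List using (List; []; _∷_; length)
open import Data.List.Relation.Unary.All using (All)
open import Relation.Nullary.Reflects using (ofʸ; ofⁿ)
open import Relation.Nullary.Negation using (contradiction)
open import Relation.Binary.PropositionalEquality using (_≡_; refl; sym; trans; cong; cong₂; subst; module ≡-Reasoning)

-- NonFull h n t and Full h n t: t is an ST-tree of height h that can arise
-- from insertions, holds n points, and is not full resp. full.
data NonFull : ℕ → ℕ → Tree → Set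
data Full : ℕ → ℕ → Tree → Set

data NonFull where
  open-leaf   : NonFull 0 0 leaf
  open-node2  : ∀ {h a b n l r} → NonFull h a l → NonFull h b r → n ≡ a + b →
                NonFull (suc h) n (node2 l r)
  open-node3L : ∀ {h a b c n l r u} → Full h a l → NonFull h b r → NonFull h c u →
                n ≡ a + b + c → NonFull (suc h) n (node3L l r u)
  open-node3R : ∀ {h a b c n l r u} → NonFull h a l → Full h b r → NonFull h c u →
                n ≡ a + b + c → NonFull (suc h) n (node3R l r u)

data Full where
  full-leaf     : Full 0 1 leaf
  full-node3L-r : ∀ {h a b c n l r u} → Full h a l → Full h b r → NonFull h c u →
                  n ≡ a + b + c → Full (suc h) n (node3L l r u)
  full-node3L-u : ∀ {h a b c n l r u} → Full h a l → NonFull h b r → Full h c u →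
                  n ≡ a + b + c → Full (suc h) n (node3L l r u)
  full-node3R-l : ∀ {h a b c n l r u} → Full h a l → Full h b r → NonFull h c u →
                  n ≡ a + b + c → Full (suc h) n (node3R l r u)
  full-node3R-u : ∀ {h a b c n l r u} → NonFull h a l → Full h b r → Full h c u →
                  n ≡ a + b + c → Full (suc h) n (node3R l r u)

ST : ℕ → ℕ → Tree → Set
ST h n t = NonFull h n t ⊎ Full h n t

cbt-NonFull : ∀ h → NonFull h 0 (cbt h)
cbt-NonFull zero    = open-leaf
cbt-NonFull (suc h) = open-node2 (cbt-NonFull h) (cbt-NonFull h) refl

Inserted : ℕ → ℕ → Res → Set
Inserted h n (done t) = NonFull h (suc n) t
Inserted h n (up t)   = Full h (suc n) t

two-Inserted : ∀ {h m n r} {f g : Tree → Tree} → Inserted h m r →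
               (∀ {t} → NonFull h (suc m) t → NonFull (suc h) (suc n) (f t)) →
               (∀ {t} → Full h (suc m) t → NonFull (suc h) (suc n) (g t)) →
               Inserted (suc h) n (two f g r)
two-Inserted {r = done _} q stays _   = stays q
two-Inserted {r = up _}   q _ grows = grows q

three-Inserted : ∀ {h m n r} {f : Tree → Tree} → Inserted h m r →
                 (∀ {t} → NonFull h (suc m) t → NonFull (suc h) (suc n) (f t)) →
                 (∀ {t} → Full h (suc m) t → Full (suc h) (suc n) (f t)) →
                 Inserted (suc h) n (three f r)
three-Inserted {r = done _} q stays _    = stays q
three-Inserted {r = up _}   q _ fills = fills q

ins-Inserted : ∀ {h n t} → NonFull h n t → ∀ o → Inserted h n (ins h o t)
ins-Inserted open-leaf o = full-leaf
ins-Inserted {suc h} (open-node2 {a = a} {b} pl pr refl) o with o <ᵇ 2 ^ h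
... | true  = two-Inserted (ins-Inserted pl o)
                (λ q → open-node2 q pr refl)
                (λ q → open-node3L q pr (cbt-NonFull h) (sym (+-identityʳ _)))
... | false = two-Inserted (ins-Inserted pr (o ∸ 2 ^ h))
                (λ q → open-node2 pl q (sym (+-suc a b)))
                (λ q → open-node3R pl q (cbt-NonFull h) (trans (sym (+-suc a b)) (sym (+-identityʳ _))))
ins-Inserted {suc h} (open-node3L {a = a} {b} {c} pl pr pu refl) o with o <ᵇ 2 ^ h
... | true  = three-Inserted (ins-Inserted pu o)
                (λ q → open-node3L pl pr q (sym (+-suc (a + b) c)))
                (λ q → full-node3L-u pl pr q (sym (+-suc (a + b) c)))
... | false = three-Inserted (ins-Inserted pr (o ∸ 2 ^ h))
                (λ q → open-node3L pl q pu (cong (_+ c) (sym (+-suc a b))))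
                (λ q → full-node3L-r pl q pu (cong (_+ c) (sym (+-suc a b))))
ins-Inserted {suc h} (open-node3R {a = a} {b} {c} pl pr pu refl) o with o <ᵇ 2 ^ h
... | true  = three-Inserted (ins-Inserted pl o)
                (λ q → open-node3R q pr pu refl)
                (λ q → full-node3R-l q pr pu refl)
... | false = three-Inserted (ins-Inserted pu (o ∸ 2 ^ h))
                (λ q → open-node3R pl pr q (sym (+-suc (a + b) c)))
                (λ q → full-node3R-u pl pr q (sym (+-suc (a + b) c)))

ins-ST : ∀ {h n t} → NonFull h n t → ∀ o → ST h (suc n) (resTree (ins h o t))
ins-ST {h} {t = t} p o = resTree-ST (ins h o t) (ins-Inserted p o)
  where
  resTree-ST : ∀ {h n} r → Inserted h n r → ST h (suc n) (resTree r)
  resTree-ST (done _) q = inj₁ q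
  resTree-ST (up _)   q = inj₂ q

size-cbt : ∀ h → suc (size (cbt h)) ≡ 2 ^ suc h
size-cbt zero    = refl
size-cbt (suc h) = begin
  suc (suc (s + s))           ≡⟨ cong suc (sym (+-suc s s)) ⟩
  suc s + suc s               ≡⟨ cong₂ _+_ (size-cbt h) (size-cbt h) ⟩
  2 ^ suc h + 2 ^ suc h       ≡⟨ cong (2 ^ suc h +_) (sym (+-identityʳ _)) ⟩
  2 ^ suc (suc h)             ∎
  where
  open ≡-Reasoning
  s = size (cbt h)

2*m≤x+y : ∀ {m x y} → m ≤ x → m ≤ y → 2 * m ≤ x + y
2*m≤x+y m≤x m≤y = +-mono-≤ m≤x (≤-trans (≤-reflexive (+-identityʳ _)) m≤y)

Full⇒2^h≤points : ∀ {h n t} → Full h n t → 2 ^ h ≤ n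
Full⇒2^h≤points full-leaf = ≤-refl
Full⇒2^h≤points (full-node3L-r {a = a} {b} {c} pl pr _ refl) =
  ≤-trans (2*m≤x+y (Full⇒2^h≤points pl) (Full⇒2^h≤points pr)) (m≤m+n (a + b) c)
Full⇒2^h≤points (full-node3L-u {a = a} {b} {c} pl _ pu refl) =
  ≤-trans (2*m≤x+y (Full⇒2^h≤points pl) (Full⇒2^h≤points pu)) (+-monoˡ-≤ c (m≤m+n a b))
Full⇒2^h≤points (full-node3R-l {a = a} {b} {c} pl pr _ refl) =
  ≤-trans (2*m≤x+y (Full⇒2^h≤points pl) (Full⇒2^h≤points pr)) (m≤m+n (a + b) c)
Full⇒2^h≤points (full-node3R-u {a = a} {b} {c} _ pr pu refl) =
  ≤-trans (2*m≤x+y (Full⇒2^h≤points pr) (Full⇒2^h≤points pu)) (+-monoˡ-≤ c (m≤n+m b a))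

size-cbt<2*n : ∀ h {n} → 2 ^ h ≤ n → size (cbt h) < 2 * n
size-cbt<2*n h 2^h≤n = ≤-trans (≤-reflexive (size-cbt h)) (*-monoʳ-≤ 2 2^h≤n)

budget : ℕ → ℕ → ℕ
budget h n = size (cbt h) + 2 * h * n

budget-node2 : ∀ h {a b x y} → x ≤ budget h a → y ≤ budget h b →
               suc (x + y) ≤ budget (suc h) (a + b)
budget-node2 h {a} {b} {x} {y} x≤ y≤ = s≤s (begin
  x + y                             ≤⟨ +-mono-≤ x≤ y≤ ⟩
  s + 2 * h * a + (s + 2 * h * b)   ≡⟨ regroup s h a b ⟩
  s + s + 2 * h * (a + b)           ≤⟨ +-monoʳ-≤ (s + s) (*-monoˡ-≤ (a + b) (*-monoʳ-≤ 2 (n≤1+n h))) ⟩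
  s + s + 2 * suc h * (a + b)       ∎)
  where
  open ≤-Reasoning
  s = size (cbt h)
  regroup : ∀ s h a b → s + 2 * h * a + (s + 2 * h * b) ≡ s + s + 2 * h * (a + b)
  regroup = solve-∀

-- The first hypothesis says that the points of the full child below the upper
-- child pay for the complete binary tree the upper child started as.
budget-node3 : ∀ h {a b c x y z} → size (cbt h) ≤ 2 * (a + b + c) →
               x ≤ budget h a → y ≤ budget h b → z ≤ budget h c →
               suc (x + y + z) ≤ budget (suc h) (a + b + c)
budget-node3 h {a} {b} {c} {x} {y} {z} paid x≤ y≤ z≤ = s≤s (begin
  x + y + z                                           ≤⟨ +-mono-≤ (+-mono-≤ x≤ y≤) z≤ ⟩
  s + 2 * h * a + (s + 2 * h * b) + (s + 2 * h * c)   ≡⟨ regroup s h a b c ⟩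
  s + s + (s + 2 * h * n)                             ≤⟨ +-monoʳ-≤ (s + s) (+-monoˡ-≤ (2 * h * n) paid) ⟩
  s + s + (2 * n + 2 * h * n)                         ≡⟨ cong (s + s +_) (factor h n) ⟩
  s + s + 2 * suc h * n                               ∎)
  where
  open ≤-Reasoning
  s = size (cbt h)
  n = a + b + c
  regroup : ∀ s h a b c → s + 2 * h * a + (s + 2 * h * b) + (s + 2 * h * c)
                          ≡ s + s + (s + 2 * h * (a + b + c))
  regroup = solve-∀
  factor : ∀ h n → 2 * n + 2 * h * n ≡ 2 * suc h * n
  factor = solve-∀

a≤a+b+c : ∀ a b c → a ≤ a + b + c
a≤a+b+c a b c = m≤n⇒m≤n+o c (m≤m+n a b)

b≤a+b+c : ∀ a b c → b ≤ a + b + c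
b≤a+b+c a b c = m≤n⇒m≤n+o c (m≤n+m b a)

upper-child-paid : ∀ {h m n t} → Full h m t → m ≤ n → size (cbt h) ≤ 2 * n
upper-child-paid {h} f m≤n = <⇒≤ (size-cbt<2*n h (≤-trans (Full⇒2^h≤points f) m≤n))

size-NonFull : ∀ {h n t} → NonFull h n t → size t ≤ budget h n
size-Full    : ∀ {h n t} → Full h n t → size t ≤ budget h n

size-NonFull open-leaf = ≤-refl
size-NonFull {suc h} (open-node2 pl pr refl) = budget-node2 h (size-NonFull pl) (size-NonFull pr)
size-NonFull {suc h} (open-node3L {a = a} {b} {c} pl pr pu refl) =
  budget-node3 h (upper-child-paid pl (a≤a+b+c a b c)) (size-Full pl) (size-NonFull pr) (size-NonFull pu)
size-NonFull {suc h} (open-node3R {a = a} {b} {c} pl pr pu refl) =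
  budget-node3 h (upper-child-paid pr (b≤a+b+c a b c)) (size-NonFull pl) (size-Full pr) (size-NonFull pu)

size-Full full-leaf = ≤-refl
size-Full {suc h} (full-node3L-r {a = a} {b} {c} pl pr pu refl) =
  budget-node3 h (upper-child-paid pl (a≤a+b+c a b c)) (size-Full pl) (size-Full pr) (size-NonFull pu)
size-Full {suc h} (full-node3L-u {a = a} {b} {c} pl pr pu refl) =
  budget-node3 h (upper-child-paid pl (a≤a+b+c a b c)) (size-Full pl) (size-NonFull pr) (size-Full pu)
size-Full {suc h} (full-node3R-l {a = a} {b} {c} pl pr pu refl) =
  budget-node3 h (upper-child-paid pr (b≤a+b+c a b c)) (size-Full pl) (size-Full pr) (size-NonFull pu)
size-Full {suc h} (full-node3R-u {a = a} {b} {c} pl pr pu refl) =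
  budget-node3 h (upper-child-paid pr (b≤a+b+c a b c)) (size-NonFull pl) (size-Full pr) (size-Full pu)

size-ST : ∀ {h n t} → ST h n t → size t ≤ budget h n
size-ST (inj₁ p) = size-NonFull p
size-ST (inj₂ p) = size-Full p

charge : ℕ → ℕ
charge k = 2 * suc k

size-compressed : ∀ {k c t} → ST k c t → 2 ^ k ≤ c → size t ≤ charge k * c
size-compressed {k} {c} {t} p 2^k≤c = begin
  size t                ≤⟨ size-ST p ⟩
  size (cbt k) + 2 * k * c
    ≤⟨ +-monoˡ-≤ (2 * k * c) (<⇒≤ (size-cbt<2*n k 2^k≤c)) ⟩
  2 * c + 2 * k * c     ≡⟨ factor k c ⟩
  charge k * c          ∎
  where
  open ≤-Reasoning
  factor : ∀ k c → 2 * c + 2 * k * c ≡ 2 * suc k * c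
  factor = solve-∀

-- After W Writes, charge k nodes per Write pay for the bottom trees and for
-- the budget of the top tree's c points.
Invariant : ℕ → ℕ → State → Set
Invariant k W (top , bot , c) = ST k c top × bot + charge k * c ≤ charge k * W

charged-write : ∀ k {x y W} → x ≤ y + charge k → y ≤ charge k * W → x ≤ charge k * suc W
charged-write k {x} {y} {W} x≤ y≤ = begin
  x                        ≤⟨ x≤ ⟩
  y + charge k             ≤⟨ +-monoˡ-≤ (charge k) y≤ ⟩
  charge k * W + charge k  ≡⟨ +-comm (charge k * W) (charge k) ⟩
  charge k + charge k * W  ≡⟨ *-suc (charge k) W ⟨
  charge k * suc W         ∎
  where open ≤-Reasoning

step-Invariant : ∀ k i {W} s → Invariant k W s → Invariant k (suc W) (step k i s)
step-Invariant k i (top , bot , c) (top-ST , paid) with c <ᵇ 2 ^ k | <ᵇ-reflects-< c (2 ^ k)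
... | true | ofʸ c<2^k =
  ins-ST (nonFull top-ST) (i ∸ 1) , charged-write k (≤-reflexive (reassoc bot (charge k) c)) paid
  where
  nonFull : ST k c top → NonFull k c top
  nonFull (inj₁ p) = p
  nonFull (inj₂ f) = contradiction (Full⇒2^h≤points f) (<⇒≱ c<2^k)
  reassoc : ∀ b m c → b + m * suc c ≡ b + m * c + m
  reassoc = solve-∀
... | false | ofⁿ c≮2^k =
  ins-ST (cbt-NonFull k) (i ∸ 1) ,
  charged-write k (+-mono-≤ (+-monoʳ-≤ bot (size-compressed top-ST (≮⇒≥ c≮2^k))) (≤-reflexive (*-identityʳ _))) paid

run-Invariant : ∀ k ws {W} s → Invariant k W s → Invariant k (W + length ws) (run k ws s)
run-Invariant k []             {W} s inv = subst (λ V → Invariant k V s) (sym (+-identityʳ W)) inv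
run-Invariant k ((i , _) ∷ ws) {W} s inv =
  subst (λ V → Invariant k V (run k ws (step k i s))) (sym (+-suc W (length ws)))
        (run-Invariant k ws (step k i s) (step-Invariant k i s inv))

bottom-nodes : ∀ ws → proj₁ (proj₂ (final ws)) ≤ charge (logU ws) * length ws
bottom-nodes ws =
  ≤-trans (m≤m+n _ _) (proj₂ (run-Invariant k ws (cbt k , 0 , 0) (inj₁ (cbt-NonFull k) , ≤-refl)))
  where k = logU ws

ternary<2*3^ : ∀ k → ternary k < 2 * 3 ^ k
ternary<2*3^ zero    = ≤-refl
ternary<2*3^ (suc k) = begin-strict
  suc (3 * ternary k)   <⟨ s≤s (s≤s (n≤1+n _)) ⟩
  3 + 3 * ternary k     ≡⟨ *-suc 3 (ternary k) ⟨
  3 * suc (ternary k)   ≤⟨ *-monoʳ-≤ 3 (ternary<2*3^ k) ⟩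
  3 * (2 * 3 ^ k)       ≡⟨ swap (3 ^ k) ⟩
  2 * 3 ^ suc k         ∎
  where
  open ≤-Reasoning
  swap : ∀ x → 3 * (2 * x) ≡ 2 * (3 * x)
  swap = solve-∀

space-≤ : ∀ k n {t b} → t < 2 * 3 ^ k → b ≤ charge k * n →
          nodeWords * t + nodeWords * b + 2 * n + 2 * 2 ^ k + 3 ≤ 29 * (3 ^ k + n * (1 + k))
space-≤ k n {t} {b} t< b≤ = begin
  12 * t + 12 * b + 2 * n + 2 * 2 ^ k + 3
    ≤⟨ +-mono-≤ (+-mono-≤ (+-mono-≤ (+-mono-≤ (*-monoʳ-≤ 12 (<⇒≤ t<)) (*-monoʳ-≤ 12 b≤))
                                    (*-monoʳ-≤ 2 (m≤m*n n (1 + k))))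
                          (*-monoʳ-≤ 2 (^-monoˡ-≤ k (n≤1+n 2))))
                (*-monoʳ-≤ 3 (m^n>0 3 k)) ⟩
  12 * (2 * X) + 12 * (charge k * n) + 2 * Y + 2 * X + 3 * X
    ≡⟨ collect X k n ⟩
  29 * X + 26 * Y              ≤⟨ +-monoʳ-≤ (29 * X) (*-monoˡ-≤ Y (m≤m+n 26 3)) ⟩
  29 * X + 29 * Y              ≡⟨ *-distribˡ-+ 29 X Y ⟨
  29 * (X + Y)                 ∎
  where
  open ≤-Reasoning
  X = 3 ^ k
  Y = n * (1 + k)
  collect : ∀ X k n → 12 * (2 * X) + 12 * (2 * suc k * n) + 2 * (n * (1 + k)) + 2 * X + 3 * X
                      ≡ 29 * X + 26 * (n * (1 + k))
  collect = solve-∀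

lemma5 : ∃[ c ] ((ws : List Write) → All (λ w → 1 ≤ proj₁ w) ws →
    space ws ≤ c * (3 ^ logU ws + length ws * (1 + logU ws)))
lemma5 = 29 , λ ws _ → space-≤ (logU ws) (length ws) (ternary<2*3^ (logU ws)) (bottom-nodes ws)
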